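{- Let $G$ and $H$ be Left dead-ends. Then $G\geq_{\mathcal{M}}H$ if and only if $o(G^\circ+H)\leq\mathscr{P}$.
   Context: Games are finite partizan games; $G\cong H$ means identical game trees; $0=\{\cdot\mid\cdot\}$, $*=\{0\mid0\}$; sum $G+H=\{G^L+H,G+H^L\mid G^R+H,G+H^R\}$. Misère outcomes: $o^L(G)=\mathscr{L}$ iff $G$ has no Left option or some $o^R(G^L)=\mathscr{L}$ (else $\mathscr{R}$); $o^R(G)=\mathscr{R}$ iff $G$ has no Right option or some $o^L(G^R)=\mathscr{R}$ (else $\mathscr{L}$); $o(G)=\mathscr{L},\mathscr{N},\mathscr{P},\mathscr{R}$ for $(o^L,o^R)=(\mathscr{L},\mathscr{L}),(\mathscr{L},\mathscr{R}),(\mathscr{R},\mathscr{L}),(\mathscr{R},\mathscr{R})$, ordered $\mathscr{L}>\mathscr{N}>\mathscr{R}$, $\mathscr{L}>\mathscr{P}>\mathscr{R}$ ($\mathscr{N},\mathscr{P}$ incomparable); so $o\leq\mathscr{P}$ means $o\in\{\mathscr{P},\mathscr{R}\}$. $G\geq_{\mathcal{M}}H$ means $o(G+X)\geq o(H+X)$ for all games $X$. A Left dead-end is a game all of whose subpositions have no Left option. For a Left dead-end $G$, its adjoint is $G^\circ=*$ if $G\cong0$, and $G^\circ=\{(G^R)^\circ\mid0\}$ otherwise, with $G^R$ ranging over the Right options of $G$. -}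

module Defs where

open import Data.Nat using (ℕ; zero; suc; _+_)
open import Data.Fin using (Fin; splitAt)
open import Data.Bool using (Bool; true; false; _∨_; not)
open import Data.Sum using (inj₁; inj₂)
open import Data.Product using (_×_)
open import Data.Unit using (⊤)
open import Relation.Binary.PropositionalEquality using (_≡_)

-- Finite partizan game: a finite family of Left options and a finite
-- family of Right options (game trees; ≅ is identity of trees).
data Game : Set where
  mk : (nl : ℕ) → (Fin nl → Game) → (nr : ℕ) → (Fin nr → Game) → Game

zeroG : Game
zeroG = mk 0 (λ ()) 0 (λ ())

star : Game
star = mk 1 (λ _ → zeroG) 1 (λ _ → zeroG)

-- disjunctive sum G + H = { G^L + H , G + H^L | G^R + H , G + H^R }
_⊕_ : Game → Game → Game
mk nl fl nr fr ⊕ mk ml gl mr gr =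
  mk (nl + ml)
     (λ i → [ (λ a → fl a ⊕ mk ml gl mr gr) , (λ b → mk nl fl nr fr ⊕ gl b) ] (splitAt nl i))
     (nr + mr)
     (λ i → [ (λ a → fr a ⊕ mk ml gl mr gr) , (λ b → mk nl fl nr fr ⊕ gr b) ] (splitAt nr i))
  where
  open import Data.Sum using ([_,_])

infixl 6 _⊕_

anyFin : (n : ℕ) → (Fin n → Bool) → Bool
anyFin zero    f = false
anyFin (suc n) f = f Fin.zero ∨ anyFin n (λ i → f (Fin.suc i))
  where import Data.Fin as Fin

isZeroℕ : ℕ → Bool
isZeroℕ zero    = true
isZeroℕ (suc _) = false

-- Misère outcomes.
-- oL-isL G = true  iff  o^L(G) = 𝓛   (Left moving first wins)
-- oR-isR G = true  iff  o^R(G) = 𝓡   (Right moving first wins)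
oL-isL : Game → Bool
oR-isR : Game → Bool
oL-isL (mk nl fl nr fr) = isZeroℕ nl ∨ anyFin nl (λ i → not (oR-isR (fl i)))
oR-isR (mk nl fl nr fr) = isZeroℕ nr ∨ anyFin nr (λ i → not (oL-isL (fr i)))

data Outcome : Set where
  𝓛 𝓝 𝓟 𝓡 : Outcome

outcomeOf : Bool → Bool → Outcome
outcomeOf true  false = 𝓛
outcomeOf true  true  = 𝓝
outcomeOf false false = 𝓟
outcomeOf false true  = 𝓡

o : Game → Outcome
o G = outcomeOf (oL-isL G) (oR-isR G)

data _≤o_ : Outcome → Outcome → Set where
  refl≤ : ∀ {x} → x ≤o x
  𝓡≤    : ∀ {x} → 𝓡 ≤o x
  ≤𝓛    : ∀ {x} → x ≤o 𝓛

infix 4 _≤o_ _≥M_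

_≥M_ : Game → Game → Set
G ≥M H = ∀ (X : Game) → o (H ⊕ X) ≤o o (G ⊕ X)

LeftDeadEnd : Game → Set
LeftDeadEnd (mk nl fl nr fr) = (nl ≡ 0) × (∀ (j : Fin nr) → LeftDeadEnd (fr j))

adjoint : Game → Game
adjoint (mk zero    fl zero     fr) = star
adjoint (mk zero    fl (suc nr) fr) = mk (suc nr) (λ j → adjoint (fr j)) 1 (λ _ → zeroG)
adjoint (mk (suc nl) fl nr      fr) = mk nr (λ j → adjoint (fr j)) 1 (λ _ → zeroG)

-- For Left dead-ends, G ≥ H comes down to a matching G ⊒ H of Right options: every G^R is
-- answered by some H^R with G^R ⊒ H^R, and H has no Right option when G has none. Such a
-- matching lets Right copy in H + X any winning first move he has in G + X, while Left can
-- only ever move in X; hence G ≥ H. Conversely, Left moving first loses G + G°, so G ≥ H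
-- makes Left lose G° + H moving first; and unfolding that loss produces the matching: Left's
-- moves go to (G^R)° + H, and Right's winning replies must be moves to (G^R)° + H^R, since
-- after the reply 0 + H Left has no move and so wins.
module Submission where

open import Defs
open import Data.Bool using (Bool; true; false; _∨_; not; _≤_; b≤b; f≤t)
open import Data.Bool.Properties
  using (≤-refl; ≤-trans; ≤-antisym; ≤-minimum; ≤-maximum
        ; ∨-assoc; ∨-comm; ∨-zeroʳ; ∨-conicalˡ; not-injective)
open import Data.Fin using (Fin; splitAt) renaming (zero to fzero; suc to fsuc)
open import Data.Nat using (ℕ; zero; suc; _+_)
open import Data.Nat.Properties using (+-comm)
open import Data.Product using (∃; _,_; map₂)
open import Data.Sum using (_⊎_; inj₁; inj₂; [_,_]; map₁)
open import Function using (_∘_)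
open import Function.Bundles using (_⇔_; mk⇔; module Equivalence)
open import Relation.Binary.PropositionalEquality
  using (_≡_; refl; sym; trans; cong; cong₂; subst; subst₂; module ≡-Reasoning)
open import Relation.Nullary using (contradiction)

open Equivalence using (to; from)

∨-mono-≤ : ∀ {a b c d} → a ≤ b → c ≤ d → a ∨ c ≤ b ∨ d
∨-mono-≤ f≤t _           = ≤-maximum _
∨-mono-≤ {false} b≤b c≤d = c≤d
∨-mono-≤ {true}  b≤b _   = b≤b

∨-lub : ∀ {a b c} → a ≤ c → b ≤ c → a ∨ b ≤ c
∨-lub {false} _   b≤c = b≤c
∨-lub {true}  b≤b _   = b≤b

x≤x∨y : ∀ x y → x ≤ x ∨ y
x≤x∨y false y = ≤-minimum y
x≤x∨y true  y = b≤b

y≤x∨y : ∀ x y → y ≤ x ∨ y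
y≤x∨y false y = ≤-refl
y≤x∨y true  y = ≤-maximum y

not-antitone : ∀ {a b} → a ≤ b → not b ≤ not a
not-antitone f≤t = f≤t
not-antitone b≤b = b≤b

≤-anyFin : ∀ {n} (f : Fin n → Bool) (i : Fin n) → f i ≤ anyFin n f
≤-anyFin f fzero    = x≤x∨y (f fzero) _
≤-anyFin f (fsuc i) = ≤-trans (≤-anyFin (f ∘ fsuc) i) (y≤x∨y (f fzero) _)

anyFin-lub : ∀ {n b} {f : Fin n → Bool} → (∀ i → f i ≤ b) → anyFin n f ≤ b
anyFin-lub {zero}  _   = ≤-minimum _
anyFin-lub {suc n} f≤b = ∨-lub (f≤b fzero) (anyFin-lub (f≤b ∘ fsuc))

anyFin-matched : ∀ {n m} {f : Fin n → Bool} {g : Fin m → Bool} →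
                 (∀ i → ∃ λ j → f i ≤ g j) → anyFin n f ≤ anyFin m g
anyFin-matched {g = g} match = anyFin-lub λ i → let j , fi≤gj = match i in ≤-trans fi≤gj (≤-anyFin g j)

anyFin-mono : ∀ {n} {f g : Fin n → Bool} → (∀ i → f i ≤ g i) → anyFin n f ≤ anyFin n g
anyFin-mono f≤g = anyFin-matched λ i → i , f≤g i

anyFin⁺ : ∀ {n} {f : Fin n → Bool} i → f i ≡ true → anyFin n f ≡ true
anyFin⁺ {f = f} i fi≡true = ≤-antisym (≤-maximum _) (subst (_≤ anyFin _ f) fi≡true (≤-anyFin f i))

anyFin⁻ : ∀ {n} {f : Fin n → Bool} → anyFin n f ≡ true → ∃ λ i → f i ≡ true
anyFin⁻ {suc n} {f} any≡true with f fzero in f0≡b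
... | true  = fzero , f0≡b
... | false = let i , fi≡true = anyFin⁻ any≡true in fsuc i , fi≡true

anyFin-false⁺ : ∀ {n} {f : Fin n → Bool} → (∀ i → f i ≡ false) → anyFin n f ≡ false
anyFin-false⁺ f≡false = ≤-antisym (anyFin-lub λ i → subst (_≤ false) (sym (f≡false i)) b≤b) (≤-minimum _)

anyFin-false⁻ : ∀ {n} {f : Fin n → Bool} → anyFin n f ≡ false → ∀ i → f i ≡ false
anyFin-false⁻ {f = f} any≡false i = ≤-antisym (subst (f i ≤_) any≡false (≤-anyFin f i)) (≤-minimum _)

anyFin-cong : ∀ {n} {f g : Fin n → Bool} → (∀ i → f i ≡ g i) → anyFin n f ≡ anyFin n g
anyFin-cong {zero}  _   = refl
anyFin-cong {suc n} f≡g = cong₂ _∨_ (f≡g fzero) (anyFin-cong (f≡g ∘ fsuc))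

anyFin-splitAt : ∀ n {m} (k : Fin n ⊎ Fin m → Bool) →
                 anyFin (n + m) (k ∘ splitAt n) ≡ anyFin n (k ∘ inj₁) ∨ anyFin m (k ∘ inj₂)
anyFin-splitAt zero    k = refl
anyFin-splitAt (suc n) k =
  trans (cong (k (inj₁ fzero) ∨_) (anyFin-splitAt n (k ∘ map₁ fsuc))) (sym (∨-assoc (k (inj₁ fzero)) _ _))

#left #right : Game → ℕ
#left  (mk nl _ _  _) = nl
#right (mk _  _ nr _) = nr

leftOption : (G : Game) → Fin (#left G) → Game
leftOption (mk _ fl _ _) = fl

rightOption : (G : Game) → Fin (#right G) → Game
rightOption (mk _ _ _ fr) = fr

oL-isL-⊕ : ∀ G X → oL-isL (G ⊕ X) ≡
  isZeroℕ (#left G + #left X) ∨ (anyFin (#left G) (λ a → not (oR-isR (leftOption G a ⊕ X)))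
                               ∨ anyFin (#left X) (λ b → not (oR-isR (G ⊕ leftOption X b))))
oL-isL-⊕ G@(mk nl fl _ _) X@(mk ml gl _ _) =
  cong (isZeroℕ (nl + ml) ∨_)
       (anyFin-splitAt nl λ s → not (oR-isR ([ (λ a → fl a ⊕ X) , (λ b → G ⊕ gl b) ] s)))

oR-isR-⊕ : ∀ G X → oR-isR (G ⊕ X) ≡
  isZeroℕ (#right G + #right X) ∨ (anyFin (#right G) (λ a → not (oL-isL (rightOption G a ⊕ X)))
                                 ∨ anyFin (#right X) (λ b → not (oL-isL (G ⊕ rightOption X b))))
oR-isR-⊕ G@(mk _ _ nr fr) X@(mk _ _ mr gr) =
  cong (isZeroℕ (nr + mr) ∨_)
       (anyFin-splitAt nr λ s → not (oL-isL ([ (λ a → fr a ⊕ X) , (λ b → G ⊕ gr b) ] s)))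

oL-isL-comm : ∀ A B → oL-isL (A ⊕ B) ≡ oL-isL (B ⊕ A)
oR-isR-comm : ∀ A B → oR-isR (A ⊕ B) ≡ oR-isR (B ⊕ A)

oL-isL-comm A@(mk nl fl _ _) B@(mk ml gl _ _) = begin
  oL-isL (A ⊕ B)
    ≡⟨ oL-isL-⊕ A B ⟩
  isZeroℕ (nl + ml) ∨ (anyFin nl (λ a → not (oR-isR (fl a ⊕ B))) ∨ anyFin ml (λ b → not (oR-isR (A ⊕ gl b))))
    ≡⟨ cong₂ (λ k x → isZeroℕ k ∨ x) (+-comm nl ml) (∨-comm (anyFin nl λ a → not (oR-isR (fl a ⊕ B))) _) ⟩
  isZeroℕ (ml + nl) ∨ (anyFin ml (λ b → not (oR-isR (A ⊕ gl b))) ∨ anyFin nl (λ a → not (oR-isR (fl a ⊕ B))))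
    ≡⟨ cong (isZeroℕ (ml + nl) ∨_) (cong₂ _∨_ (anyFin-cong λ b → cong not (oR-isR-comm A (gl b)))
                                               (anyFin-cong λ a → cong not (oR-isR-comm (fl a) B))) ⟩
  isZeroℕ (ml + nl) ∨ (anyFin ml (λ b → not (oR-isR (gl b ⊕ A))) ∨ anyFin nl (λ a → not (oR-isR (B ⊕ fl a))))
    ≡⟨ oL-isL-⊕ B A ⟨
  oL-isL (B ⊕ A) ∎
  where open ≡-Reasoning

oR-isR-comm A@(mk _ _ nr fr) B@(mk _ _ mr gr) = begin
  oR-isR (A ⊕ B)
    ≡⟨ oR-isR-⊕ A B ⟩
  isZeroℕ (nr + mr) ∨ (anyFin nr (λ a → not (oL-isL (fr a ⊕ B))) ∨ anyFin mr (λ b → not (oL-isL (A ⊕ gr b))))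
    ≡⟨ cong₂ (λ k x → isZeroℕ k ∨ x) (+-comm nr mr) (∨-comm (anyFin nr λ a → not (oL-isL (fr a ⊕ B))) _) ⟩
  isZeroℕ (mr + nr) ∨ (anyFin mr (λ b → not (oL-isL (A ⊕ gr b))) ∨ anyFin nr (λ a → not (oL-isL (fr a ⊕ B))))
    ≡⟨ cong (isZeroℕ (mr + nr) ∨_) (cong₂ _∨_ (anyFin-cong λ b → cong not (oL-isL-comm A (gr b)))
                                               (anyFin-cong λ a → cong not (oL-isL-comm (fr a) B))) ⟩
  isZeroℕ (mr + nr) ∨ (anyFin mr (λ b → not (oL-isL (gr b ⊕ A))) ∨ anyFin nr (λ a → not (oL-isL (B ⊕ fr a))))
    ≡⟨ oR-isR-⊕ B A ⟨
  oR-isR (B ⊕ A) ∎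
  where open ≡-Reasoning

≤o-trans : ∀ {x y z} → x ≤o y → y ≤o z → x ≤o z
≤o-trans refl≤ y≤z  = y≤z
≤o-trans 𝓡≤    _    = 𝓡≤
≤o-trans ≤𝓛    refl≤ = ≤𝓛
≤o-trans ≤𝓛    ≤𝓛   = ≤𝓛

outcomeOf-mono : ∀ {a b c d} → a ≤ c → d ≤ b → outcomeOf a b ≤o outcomeOf c d
outcomeOf-mono {false} {true}                 _ _ = 𝓡≤
outcomeOf-mono {true}  {_}     {true} {false} _ _ = ≤𝓛
outcomeOf-mono {false} {false} {true} {false} _ _ = ≤𝓛
outcomeOf-mono b≤b b≤b                            = refl≤

outcomeOf-≤𝓟 : ∀ a b → outcomeOf a b ≤o 𝓟 ⇔ a ≡ false
outcomeOf-≤𝓟 false false = mk⇔ (λ _ → refl) (λ _ → refl≤)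
outcomeOf-≤𝓟 false true  = mk⇔ (λ _ → refl) (λ _ → 𝓡≤)
outcomeOf-≤𝓟 true  false = mk⇔ (λ ()) (λ ())
outcomeOf-≤𝓟 true  true  = mk⇔ (λ ()) (λ ())

o-≤𝓟 : ∀ G → o G ≤o 𝓟 ⇔ oL-isL G ≡ false
o-≤𝓟 G = outcomeOf-≤𝓟 (oL-isL G) (oR-isR G)

oL-isL-zero⊕ : ∀ Y → LeftDeadEnd Y → oL-isL (zeroG ⊕ Y) ≡ true
oL-isL-zero⊕ (mk _ _ _ _) (refl , _) = refl

infix 4 _⊒_

data _⊒_ : Game → Game → Set where
  ⊒-end  : ∀ {nl fl fr ml hl hr} → mk nl fl 0 fr ⊒ mk ml hl 0 hr
  ⊒-step : ∀ {nl fl n fr ml hl mr hr} →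
           (∀ j → ∃ λ k → fr j ⊒ hr k) → mk nl fl (suc n) fr ⊒ mk ml hl mr hr

⊒-oL-isL : ∀ {G H} X → LeftDeadEnd G → LeftDeadEnd H → G ⊒ H → oL-isL (H ⊕ X) ≤ oL-isL (G ⊕ X)
⊒-oR-isR : ∀ {G H} X → LeftDeadEnd G → LeftDeadEnd H → G ⊒ H → oR-isR (G ⊕ X) ≤ oR-isR (H ⊕ X)

-- Neither G nor H has a Left option, so Left's moves in G + X and in H + X are the same moves in X.
⊒-oL-isL {mk _ _ _ _} {mk _ _ _ _} (mk _ xl _ _) dG@(refl , _) dH@(refl , _) G⊒H =
  ∨-mono-≤ ≤-refl (anyFin-mono λ b → not-antitone (⊒-oR-isR (xl b) dG dH G⊒H))

⊒-oR-isR X@(mk _ _ _ xr) dG@(refl , _) dH@(refl , _) ⊒-end =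
  ∨-mono-≤ ≤-refl (anyFin-mono λ b → not-antitone (⊒-oL-isL (xr b) dG dH ⊒-end))
-- A winning first move of Right in G to G^R is copied in H by the matching H^R.
⊒-oR-isR {G} {H} X@(mk _ _ _ xr) dG@(refl , dg) dH@(refl , dh) (⊒-step match) =
  subst₂ _≤_ (sym (oR-isR-⊕ G X)) (sym (oR-isR-⊕ H X))
    (∨-mono-≤ (≤-minimum (isZeroℕ (#right H + #right X)))
      (∨-mono-≤ (anyFin-matched λ j → let k , gj⊒hk = match j in
                                       k , not-antitone (⊒-oL-isL X (dg j) (dh k) gj⊒hk))
                (anyFin-mono λ b → not-antitone (⊒-oL-isL {G} {H} (xr b) dG dH (⊒-step match)))))

⊒⇒≥M : ∀ {G H} → LeftDeadEnd G → LeftDeadEnd H → G ⊒ H → G ≥M H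
⊒⇒≥M dG dH G⊒H X = outcomeOf-mono (⊒-oL-isL X dG dH G⊒H) (⊒-oR-isR X dG dH G⊒H)

oR-isR-⊕-byRightOption : ∀ G W (j : Fin (#right G)) →
                         oL-isL (rightOption G j ⊕ W) ≡ false → oR-isR (G ⊕ W) ≡ true
oR-isR-⊕-byRightOption G W j Gʲ+W-lost = begin
  oR-isR (G ⊕ W)
    ≡⟨ oR-isR-⊕ G W ⟩
  isZeroℕ (#right G + #right W) ∨ (anyFin (#right G) _ ∨ movesInW)
    ≡⟨ cong (λ x → isZeroℕ (#right G + #right W) ∨ (x ∨ movesInW)) (anyFin⁺ j (cong not Gʲ+W-lost)) ⟩
  isZeroℕ (#right G + #right W) ∨ true
    ≡⟨ ∨-zeroʳ _ ⟩
  true ∎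
  where
  open ≡-Reasoning
  movesInW : Bool
  movesInW = anyFin (#right W) λ b → not (oL-isL (G ⊕ rightOption W b))

-- Left's moves are to G + (G^R)°, and Right answers each by the mirror move to G^R + (G^R)°.
oL-isL-⊕-adjoint : ∀ {G} → LeftDeadEnd G → oL-isL (G ⊕ adjoint G) ≡ false
oL-isL-⊕-adjoint {mk _ _ zero    _}  (refl , _)  = refl
oL-isL-⊕-adjoint {G@(mk _ _ (suc _) gr)} (refl , dg) =
  anyFin-false⁺ λ j → cong not (oR-isR-⊕-byRightOption G (adjoint (gr j)) j (oL-isL-⊕-adjoint (dg j)))

-- Right's move to 0 + H cannot win: Left, moving next, has no move there.
oR-isR-onlyRightZero⊕ : ∀ {nl fl H} → LeftDeadEnd H →
  oR-isR (mk nl fl 1 (λ _ → zeroG) ⊕ H) ≡ true →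
  ∃ λ k → oL-isL (mk nl fl 1 (λ _ → zeroG) ⊕ rightOption H k) ≡ false
oR-isR-onlyRightZero⊕ {nl} {fl} {H@(mk _ _ kr hr)} dH@(refl , _) Right-wins = map₂ not-injective winningMove
  where
  movesInH : Bool
  movesInH = anyFin kr λ b → not (oL-isL (mk nl fl 1 (λ _ → zeroG) ⊕ hr b))
  winningMove : ∃ λ k → not (oL-isL (mk nl fl 1 (λ _ → zeroG) ⊕ hr k)) ≡ true
  winningMove = anyFin⁻ (subst (λ x → not x ∨ movesInH ≡ true) (oL-isL-zero⊕ H dH) Right-wins)

oR-isR-adjoint⊕ : ∀ {Y H} → LeftDeadEnd Y → LeftDeadEnd H →
  oR-isR (adjoint Y ⊕ H) ≡ true → ∃ λ k → oL-isL (adjoint Y ⊕ rightOption H k) ≡ false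
oR-isR-adjoint⊕ {mk _ _ zero    _} (refl , _) = oR-isR-onlyRightZero⊕
oR-isR-adjoint⊕ {mk _ _ (suc _) _} (refl , _) = oR-isR-onlyRightZero⊕

adjoint-⊒ : ∀ {G H} → LeftDeadEnd G → LeftDeadEnd H → oL-isL (adjoint G ⊕ H) ≡ false → G ⊒ H
adjoint-⊒ {mk _ _ zero _} {mk _ _ zero    _ } _          _           _    = ⊒-end
-- Left moves * + H to 0 + H, after which Right must move to some 0 + H^R, leaving Left without a move.
adjoint-⊒ {mk _ _ zero _} {mk _ _ (suc _) hr} (refl , _) (refl , dh) lost =
  contradiction (subst (λ x → not x ∨ false ≡ false) Right-loses lost) λ ()
  where
  Right-loses : anyFin _ (λ i → not (oL-isL (zeroG ⊕ hr i))) ≡ false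
  Right-loses = anyFin-false⁺ λ i → cong not (oL-isL-zero⊕ (hr i) (dh i))
adjoint-⊒ {G@(mk _ _ (suc _) gr)} {H@(mk _ _ _ _)} (refl , dg) dH@(refl , dh) lost =
  ⊒-step λ j → let k , lostʲᵏ = oR-isR-adjoint⊕ (dg j) dH (answered j) in k , adjoint-⊒ (dg j) (dh k) lostʲᵏ
  where
  answered : ∀ j → oR-isR (adjoint (gr j) ⊕ H) ≡ true
  answered = not-injective ∘ anyFin-false⁻ (∨-conicalˡ _ false (trans (sym (oL-isL-⊕ (adjoint G) H)) lost))

lemma4p5 : (G H : Game) → LeftDeadEnd G → LeftDeadEnd H →
    (G ≥M H) ⇔ (o (adjoint G ⊕ H) ≤o 𝓟)
lemma4p5 G H dG dH = mk⇔ necessary sufficient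
  where
  necessary : G ≥M H → o (adjoint G ⊕ H) ≤o 𝓟
  necessary G≥H = o-≤𝓟 (adjoint G ⊕ H) .from (trans (oL-isL-comm (adjoint G) H) H+G°-lost)
    where
    H+G°-lost : oL-isL (H ⊕ adjoint G) ≡ false
    H+G°-lost = o-≤𝓟 (H ⊕ adjoint G) .to
      (≤o-trans (G≥H (adjoint G)) (o-≤𝓟 (G ⊕ adjoint G) .from (oL-isL-⊕-adjoint dG)))

  sufficient : o (adjoint G ⊕ H) ≤o 𝓟 → G ≥M H
  sufficient G°+H≤𝓟 = ⊒⇒≥M dG dH (adjoint-⊒ dG dH (o-≤𝓟 (adjoint G ⊕ H) .to G°+H≤𝓟))
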